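{- Let $G=(V,E)$ be a connected finite simple graph with $|V|=|E|=n\ge 3$. Then for every spanning tree $T$ of $G$, $noc(G)<noc(T)$.
   Context: For a finite simple undirected graph $G=(V,E)$, a set $S\subseteq V$ is called $P_3$-convex if for every path $x$--$z$--$y$ in $G$ (distinct vertices $x,z,y$ with $xz,zy\in E$) with $x,y\in S$, we also have $z\in S$. The number $noc(G)$ denotes the number of $P_3$-convex subsets of $V$ (including $\emptyset$). -}

module Defs where

open import Data.Bool using (Bool; true; false; _∧_; _∨_; not; if_then_else_)
open import Data.Nat using (ℕ; zero; suc; _<_; _≤_; _<ᵇ_)
open import Data.Fin using (Fin; toℕ; _≟_)
open import Data.List using (List; []; _∷_; length; filter; map; concatMap; allFin; head; last)
open import Data.Bool.ListAction using (and)
open import Data.List.Relation.Unary.Linked using (Linked)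
open import Data.List.Relation.Unary.Unique.Propositional using (Unique)
open import Data.Vec using (Vec; []; _∷_; lookup)
open import Data.Product using (Σ; _×_; _,_; ∃)
open import Data.Maybe using (Maybe; just; nothing)
open import Relation.Nullary using (¬_; does)
open import Relation.Binary.PropositionalEquality using (_≡_)
open import Relation.Unary using (Pred)
open import Data.Bool using (T)

record Graph (n : ℕ) : Set where
  field
    adj    : Fin n → Fin n → Bool
    sym    : ∀ i j → adj i j ≡ adj j i
    irrefl : ∀ i → adj i i ≡ false
open Graph public

Adj : ∀ {n} → Graph n → Fin n → Fin n → Set
Adj G i j = adj G i j ≡ true

data Walk {n : ℕ} (G : Graph n) : Fin n → Fin n → Set where
  here : ∀ {u} → Walk G u u
  step : ∀ {u w v} → Adj G u w → Walk G w v → Walk G u v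

Connected : ∀ {n} → Graph n → Set
Connected G = ∀ u v → Walk G u v

record Cycle {n : ℕ} (G : Graph n) : Set where
  field
    verts     : List (Fin n)
    long      : 3 ≤ length verts
    distinct  : Unique verts
    path      : Linked (Adj G) verts
    first lst : Fin n
    isFirst   : head verts ≡ just first
    isLast    : last verts ≡ just lst
    closing   : Adj G lst first

Acyclic : ∀ {n} → Graph n → Set
Acyclic G = ¬ Cycle G

IsTree : ∀ {n} → Graph n → Set
IsTree T = Connected T × Acyclic T

SubgraphOf : ∀ {n} → Graph n → Graph n → Set
SubgraphOf T G = ∀ i j → Adj T i j → Adj G i j

IsSpanningTree : ∀ {n} → Graph n → Graph n → Set
IsSpanningTree T G = SubgraphOf T G × IsTree T

countᵇ : ∀ {A : Set} → (A → Bool) → List A → ℕ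
countᵇ p []       = 0
countᵇ p (x ∷ xs) = if p x then suc (countᵇ p xs) else countᵇ p xs

pairs : (n : ℕ) → List (Fin n × Fin n)
pairs n = concatMap (λ i → map (λ j → (i , j)) (allFin n)) (allFin n)

numEdges : ∀ {n} → Graph n → ℕ
numEdges {n} G = countᵇ (λ { (i , j) → (toℕ i <ᵇ toℕ j) ∧ adj G i j }) (pairs n)

subsets : (n : ℕ) → List (Vec Bool n)
subsets zero    = [] ∷ []
subsets (suc n) = concatMap (λ s → (false ∷ s) ∷ (true ∷ s) ∷ []) (subsets n)

triples : (n : ℕ) → List (Fin n × Fin n × Fin n)
triples n = concatMap (λ x → concatMap (λ z → map (λ y → (x , z , y)) (allFin n)) (allFin n)) (allFin n)

isP3Convex : ∀ {n} → Graph n → Vec Bool n → Bool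
isP3Convex {n} G S = and (map ok (triples n))
  where
  neq : Fin n → Fin n → Bool
  neq a b = not (does (a ≟ b))
  ok : Fin n × Fin n × Fin n → Bool
  ok (x , z , y) =
    not (neq x z ∧ neq z y ∧ neq x y ∧ adj G x z ∧ adj G z y ∧ lookup S x ∧ lookup S y)
    ∨ lookup S z

-- noc(G): number of P3-convex subsets of V (including ∅).
noc : ∀ {n} → Graph n → ℕ
noc {n} G = countᵇ (isP3Convex G) (subsets n)

{-# OPTIONS --safe #-}
module Submission where

-- An acyclic graph on n ≥ 1 vertices has at most n − 1 edges: a maximal path in it ends in a vertex
-- with at most one neighbour, and removing that vertex loses at most one edge. Hence G, with n edges,
-- has an edge uv outside T. Let u, w, …, v be the path from u to v in T and S = {w, …, v}. A vertex
-- outside S adjacent in T to two vertices of S would close a cycle, so S is P3-convex in T; but S is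
-- not P3-convex in G because of the path v–u–w. Every P3-convex set of G is P3-convex in the subgraph
-- T, so noc G < noc T.

open import Defs
open import Data.Nat using (ℕ; _≤_; _<_)
open import Relation.Binary.PropositionalEquality using (_≡_)

open import Data.Bool using (Bool; true; false; _∧_; _∨_; not; T)
open import Data.Bool.Properties using (T-≡; T-∧; ∧-identityʳ) renaming (_≟_ to _≟ᵇ_)
open import Data.Empty using (⊥-elim)
open import Data.Fin using (Fin; toℕ; _≟_)
open import Data.Fin.Properties using (any?; injective⇒≤)
open import Data.List using (List; []; _∷_; _++_; length; last; allFin; map; concatMap; cartesianProduct; lookup)
open import Data.List.Properties using (length-tabulate)
open import Data.List.Membership.Propositional using (_∈_; _∉_; lose)
open import Data.List.Membership.Propositional.Properties using (∈-allFin; ∈-map⁺; ∈-concatMap⁺; ∈-lookup)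
open import Data.List.Relation.Unary.All as All using (All; []; _∷_)
open import Data.List.Relation.Unary.All.Properties using (all⁺; all⁻; ¬Any⇒All¬)
open import Data.List.Relation.Unary.AllPairs using ([]; _∷_)
open import Data.List.Relation.Unary.Any using (here; there)
open import Data.List.Relation.Unary.Linked as Linked using (Linked; []; [-]; _∷_)
open import Data.List.Relation.Unary.Unique.Propositional using (Unique)
open import Data.List.Relation.Unary.Unique.Propositional.Properties using (allFin⁺; cartesianProduct⁺)
open import Data.Maybe using (just)
open import Data.Nat using (zero; suc; pred; _+_; z≤n; s≤s; z<s; _<ᵇ_)
open import Data.Nat.Properties
  using (≤-trans; <-pred; ≤-reflexive; <-trans; <-asym; <⇒≱; ≮⇒≥; n≮0; n<1+n; m<m+n; m≤n⇒m≤1+n; m<n⇒m<1+n;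
         pred[n]≤n; +-suc; +-comm; +-identityʳ; +-monoˡ-≤; suc-injective; <ᵇ⇒<; module ≤-Reasoning)
open import Data.Product using (_×_; _,_; proj₁; proj₂; ∃; ∃₂)
open import Data.Sum as Sum using (_⊎_; inj₁; inj₂)
open import Data.Vec using (Vec; []; _∷_; tabulate) renaming (lookup to vlookup)
open import Data.Vec.Properties using (lookup∘tabulate)
open import Function using (_∘_; Equivalence)
open import Relation.Binary.PropositionalEquality as ≡ using (refl; _≢_)
open import Relation.Nullary using (¬_; Dec; yes; no; does)
open import Relation.Nullary.Decidable
  using (T?; ⌊_⌋; _×-dec_; ¬?; dec-false; decidable-stable; fromWitness; toWitness)

module _ {A : Set} where

  countᵇ-cong : ∀ {p q : A → Bool} xs → (∀ {t} → t ∈ xs → p t ≡ q t) → countᵇ p xs ≡ countᵇ q xs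
  countᵇ-cong []       p≗q = refl
  countᵇ-cong (x ∷ xs) p≗q rewrite p≗q (here refl) | countᵇ-cong xs (p≗q ∘ there) = refl

  countᵇ-true : ∀ xs → countᵇ (λ (_ : A) → true) xs ≡ length xs
  countᵇ-true []       = refl
  countᵇ-true (x ∷ xs) = ≡.cong suc (countᵇ-true xs)

  countᵇ-mono : ∀ {p q : A → Bool} → (∀ {t} → T (p t) → T (q t)) → ∀ xs → countᵇ p xs ≤ countᵇ q xs
  countᵇ-mono p⇒q [] = z≤n
  countᵇ-mono {p} {q} p⇒q (x ∷ xs) with p x | q x | p⇒q {x}
  ... | true  | true  | _      = s≤s (countᵇ-mono p⇒q xs)
  ... | true  | false | px⇒qx = ⊥-elim (px⇒qx _)
  ... | false | true  | _      = m≤n⇒m≤1+n (countᵇ-mono p⇒q xs)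
  ... | false | false | _      = countᵇ-mono p⇒q xs

  countᵇ-mono-< : ∀ {p q : A → Bool} {s} xs → (∀ {t} → T (p t) → T (q t)) →
                  s ∈ xs → ¬ T (p s) → T (q s) → countᵇ p xs < countᵇ q xs
  countᵇ-mono-< {p} {q} (x ∷ xs) p⇒q (here refl) ¬ps qs with p x | q x
  ... | true  | _     = ⊥-elim (¬ps _)
  ... | false | true  = s≤s (countᵇ-mono p⇒q xs)
  ... | false | false = ⊥-elim qs
  countᵇ-mono-< {p} {q} (x ∷ xs) p⇒q (there s∈xs) ¬ps qs with p x | q x | p⇒q {x}
  ... | true  | true  | _      = s≤s (countᵇ-mono-< xs p⇒q s∈xs ¬ps qs)
  ... | true  | false | px⇒qx = ⊥-elim (px⇒qx _)
  ... | false | true  | _      = m<n⇒m<1+n (countᵇ-mono-< xs p⇒q s∈xs ¬ps qs)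
  ... | false | false | _      = countᵇ-mono-< xs p⇒q s∈xs ¬ps qs

  countᵇ-<⇒∃ : ∀ {p q : A → Bool} xs → countᵇ p xs < countᵇ q xs → ∃ λ t → ¬ T (p t) × T (q t)
  countᵇ-<⇒∃ {p} {q} (x ∷ xs) p<q with p x in px | q x in qx
  ... | true  | true  = countᵇ-<⇒∃ xs (<-pred p<q)
  ... | true  | false = countᵇ-<⇒∃ xs (<-trans (n<1+n _) p<q)
  ... | false | true  = x , ≡.subst T px , ≡.subst T (≡.sym qx) _
  ... | false | false = countᵇ-<⇒∃ xs p<q

  countᵇ>0⇒∃ : ∀ {p : A → Bool} xs → 0 < countᵇ p xs → ∃ λ t → t ∈ xs × T (p t)
  countᵇ>0⇒∃ {p} (x ∷ xs) pos with p x in px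
  ... | true  = x , here refl , ≡.subst T (≡.sym px) _
  ... | false with t , t∈xs , pt ← countᵇ>0⇒∃ xs pos = t , there t∈xs , pt

  ∈⇒countᵇ>0 : ∀ {p : A → Bool} {t} xs → t ∈ xs → T (p t) → 0 < countᵇ p xs
  ∈⇒countᵇ>0 {p} (x ∷ xs) (here refl) pt with p x
  ... | true  = z<s
  ... | false = ⊥-elim pt
  ∈⇒countᵇ>0 {p} (x ∷ xs) (there t∈xs) pt with p x
  ... | true  = z<s
  ... | false = ∈⇒countᵇ>0 xs t∈xs pt

  countᵇ-≤-+ : ∀ (p q : A → Bool) xs → countᵇ p xs ≤ countᵇ q xs + countᵇ (λ t → p t ∧ not (q t)) xs
  countᵇ-≤-+ p q [] = z≤n
  countᵇ-≤-+ p q (x ∷ xs) with p x | q x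
  ... | true  | true  = s≤s (countᵇ-≤-+ p q xs)
  ... | true  | false = ≤-trans (s≤s (countᵇ-≤-+ p q xs)) (≤-reflexive (≡.sym (+-suc _ _)))
  ... | false | true  = m≤n⇒m≤1+n (countᵇ-≤-+ p q xs)
  ... | false | false = countᵇ-≤-+ p q xs

  countᵇ-≤1 : ∀ {p : A → Bool} xs → Unique xs → (∀ {s t} → T (p s) → T (p t) → s ≡ t) → countᵇ p xs ≤ 1
  countᵇ-≤1 [] _ _ = z≤n
  countᵇ-≤1 {p} (x ∷ xs) (x∉xs ∷ distinct) unique with p x in px
  ... | true  = s≤s (≮⇒≥ λ pos →
        let t , t∈xs , pt = countᵇ>0⇒∃ xs pos in All.lookup x∉xs t∈xs (unique (≡.subst T (≡.sym px) _) pt))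
  ... | false = countᵇ-≤1 xs distinct unique

  countᵇ-remove : ∀ {p q : A → Bool} {s} xs → Unique xs → s ∈ xs → T (p s) → ¬ T (q s) →
                  (∀ {t} → t ≢ s → q t ≡ p t) → countᵇ p xs ≡ suc (countᵇ q xs)
  countᵇ-remove {p} {q} (x ∷ xs) (x∉xs ∷ _) (here refl) ps ¬qs q≗p with p x | q x
  ... | false | _     = ⊥-elim ps
  ... | true  | true  = ⊥-elim (¬qs _)
  ... | true  | false =
    ≡.cong suc (≡.sym (countᵇ-cong xs λ t∈xs → q≗p λ t≡x → All.lookup x∉xs t∈xs (≡.sym t≡x)))
  countᵇ-remove {p} {q} (x ∷ xs) (x∉xs ∷ distinct) (there s∈xs) ps ¬qs q≗p
    rewrite q≗p (All.lookup x∉xs s∈xs) with p x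
  ... | true  = ≡.cong suc (countᵇ-remove xs distinct s∈xs ps ¬qs q≗p)
  ... | false = countᵇ-remove xs distinct s∈xs ps ¬qs q≗p

  lookup-injective : ∀ {xs : List A} → Unique xs → ∀ {i j} → lookup xs i ≡ lookup xs j → i ≡ j
  lookup-injective (_ ∷ _)        {Fin.zero}  {Fin.zero}  _  = refl
  lookup-injective (x∉xs ∷ _)     {Fin.zero}  {Fin.suc j} eq = ⊥-elim (All.lookup x∉xs (∈-lookup j) eq)
  lookup-injective (x∉xs ∷ _)     {Fin.suc i} {Fin.zero}  eq = ⊥-elim (All.lookup x∉xs (∈-lookup i) (≡.sym eq))
  lookup-injective (_ ∷ distinct) {Fin.suc i} {Fin.suc j} eq = ≡.cong Fin.suc (lookup-injective distinct eq)

  last⇒∈ : ∀ {v : A} xs → last xs ≡ just v → v ∈ xs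
  last⇒∈ (x ∷ [])     refl = here refl
  last⇒∈ (x ∷ y ∷ xs) eq   = there (last⇒∈ (y ∷ xs) eq)

  prefixTo : ∀ {y : A} {xs} → y ∈ xs → List A
  prefixTo {xs = x ∷ _} (here _)     = x ∷ []
  prefixTo {xs = x ∷ _} (there y∈xs) = x ∷ prefixTo y∈xs

  length-prefixTo : ∀ {y : A} {xs} (y∈xs : y ∈ xs) → 0 < length (prefixTo y∈xs)
  length-prefixTo (here _)  = z<s
  length-prefixTo (there _) = z<s

  last-prefixTo : ∀ {y : A} {xs} (y∈xs : y ∈ xs) → last (prefixTo y∈xs) ≡ just y
  last-prefixTo                      (here refl)         = refl
  last-prefixTo {xs = _ ∷ _ ∷ _}     (there (here refl)) = refl
  last-prefixTo {xs = _ ∷ _ ∷ _}     (there (there y∈xs)) = last-prefixTo (there y∈xs)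

  prefixTo-All : ∀ {P : A → Set} {y xs} → All P xs → (y∈xs : y ∈ xs) → All P (prefixTo y∈xs)
  prefixTo-All (px ∷ _)   (here _)     = px ∷ []
  prefixTo-All (px ∷ pxs) (there y∈xs) = px ∷ prefixTo-All pxs y∈xs

  prefixTo-Unique : ∀ {y xs} → Unique xs → (y∈xs : y ∈ xs) → Unique (prefixTo y∈xs)
  prefixTo-Unique (_ ∷ _)           (here _)     = [] ∷ []
  prefixTo-Unique (x∉xs ∷ distinct) (there y∈xs) = prefixTo-All x∉xs y∈xs ∷ prefixTo-Unique distinct y∈xs

  prefixTo-Linked : ∀ {R : A → A → Set} {y xs} → Linked R xs → (y∈xs : y ∈ xs) → Linked R (prefixTo y∈xs)
  prefixTo-Linked _        (here _)             = [-]
  prefixTo-Linked (r ∷ _)  (there (here _))     = r ∷ [-]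
  prefixTo-Linked (r ∷ rs) (there (there y∈xs)) = r ∷ prefixTo-Linked rs (there y∈xs)

  suffixFrom : ∀ {y : A} {xs} → y ∈ xs → List A
  suffixFrom {xs = _ ∷ xs} (here _)     = xs
  suffixFrom               (there y∈xs) = suffixFrom y∈xs

  last-suffixFrom : ∀ {y : A} {xs} (y∈xs : y ∈ xs) → last (y ∷ suffixFrom y∈xs) ≡ last xs
  last-suffixFrom                  (here refl)  = refl
  last-suffixFrom {xs = _ ∷ _ ∷ _} (there y∈xs) = last-suffixFrom y∈xs

  suffixFrom-Unique : ∀ {y xs} → Unique xs → (y∈xs : y ∈ xs) → Unique (y ∷ suffixFrom y∈xs)
  suffixFrom-Unique distinct       (here refl)  = distinct
  suffixFrom-Unique (_ ∷ distinct) (there y∈xs) = suffixFrom-Unique distinct y∈xs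

  suffixFrom-Linked : ∀ {R : A → A → Set} {y xs} → Linked R xs → (y∈xs : y ∈ xs) →
                      Linked R (y ∷ suffixFrom y∈xs)
  suffixFrom-Linked linked (here refl)  = linked
  suffixFrom-Linked linked (there y∈xs) = suffixFrom-Linked (Linked.tail linked) y∈xs

  concatMap-pairs≡cartesianProduct : ∀ {B : Set} (xs : List A) (ys : List B) →
                                     concatMap (λ x → map (λ y → (x , y)) ys) xs ≡ cartesianProduct xs ys
  concatMap-pairs≡cartesianProduct []       ys = refl
  concatMap-pairs≡cartesianProduct (x ∷ xs) ys =
    ≡.cong (map (x ,_) ys ++_) (concatMap-pairs≡cartesianProduct xs ys)

∈-subsets : ∀ {m} (s : Vec Bool m) → s ∈ subsets m
∈-subsets []      = here refl
∈-subsets (b ∷ s) = ∈-concatMap⁺ _ (lose (∈-subsets s) (∈-pair b))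
  where
  ∈-pair : ∀ b → b ∷ s ∈ (false ∷ s) ∷ (true ∷ s) ∷ []
  ∈-pair false = here refl
  ∈-pair true  = there (here refl)

-- The test in isP3Convex has the shape not (a₁ ∧ … ∧ aₖ) ∨ c, a curried implication a₁ → … → aₖ → c;
-- λᵇ and _$ᵇ_ introduce and eliminate it one premise at a time.
infixl 5 _$ᵇ_

_$ᵇ_ : ∀ {a b c} → T (not (a ∧ b) ∨ c) → T a → T (not b ∨ c)
_$ᵇ_ {true} h _ = h

$ᵇ-last : ∀ {a c} → T (not a ∨ c) → T a → T c
$ᵇ-last {true} h _ = h

λᵇ : ∀ a {b c} → (T a → T (not b ∨ c)) → T (not (a ∧ b) ∨ c)
λᵇ false _ = _
λᵇ true  h = h _

λᵇ-last : ∀ a {c} → (T a → T c) → T (not a ∨ c)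
λᵇ-last false _ = _
λᵇ-last true  h = h _

T-not-does⁺ : ∀ {P : Set} (p? : Dec P) → ¬ P → T (not (does p?))
T-not-does⁺ (yes p) ¬p = ¬p p
T-not-does⁺ (no _)  _  = _

T-not-does⁻ : ∀ {P : Set} (p? : Dec P) → T (not (does p?)) → ¬ P
T-not-does⁻ (no ¬p) _ = ¬p

T-does⁻ : ∀ {P : Set} (p? : Dec P) → T (does p?) → P
T-does⁻ (yes p) _ = p

pred-+-≤ : ∀ {m r} → r ≤ 1 → (0 < r → 0 < m) → pred m + r ≤ m
pred-+-≤ {m}     z≤n       _       = ≤-trans (≤-reflexive (+-identityʳ (pred m))) pred[n]≤n
pred-+-≤ {zero}  (s≤s z≤n) r>0⇒m>0 = ⊥-elim (n≮0 (r>0⇒m>0 z<s))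
pred-+-≤ {suc m} (s≤s z≤n) _       = ≤-reflexive (+-comm m 1)

module _ {n : ℕ} where

  open import Data.List.Membership.DecPropositional (_≟_ {n}) using (_∈?_)

  Unique⇒length≤ : ∀ {xs : List (Fin n)} → Unique xs → length xs ≤ n
  Unique⇒length≤ {xs} distinct = injective⇒≤ {f = lookup xs} (lookup-injective distinct)

  Unique-pairs : Unique (pairs n)
  Unique-pairs = ≡.subst Unique (≡.sym (concatMap-pairs≡cartesianProduct (allFin n) (allFin n)))
                   (cartesianProduct⁺ (allFin⁺ n) (allFin⁺ n))

  ∈-triples : ∀ x z y → (x , z , y) ∈ triples n
  ∈-triples x z y =
    ∈-concatMap⁺ _ (lose (∈-allFin x) (∈-concatMap⁺ _ (lose (∈-allFin z) (∈-map⁺ _ (∈-allFin y)))))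

  Adj-sym : ∀ (G : Graph n) {i j} → Adj G i j → Adj G j i
  Adj-sym G {i} {j} ij = ≡.trans (sym G j i) ij

  Adj-irrefl : ∀ (G : Graph n) {i j} → Adj G i j → i ≢ j
  Adj-irrefl G {i} ii refl with () ← ≡.trans (≡.sym ii) (irrefl G i)

  record SimplePath (G : Graph n) (vs : List (Fin n)) : Set where
    constructor simplePath
    field
      distinct : Unique vs
      linked   : Linked (Adj G) vs

  SimplePath-tail : ∀ {G : Graph n} {v vs} → SimplePath G (v ∷ vs) → SimplePath G vs
  SimplePath-tail (simplePath (_ ∷ distinct) linked) = simplePath distinct (Linked.tail linked)

  walk⇒SimplePath : ∀ {G : Graph n} {u v} → Walk G u v →
                    ∃ λ vs → SimplePath G (u ∷ vs) × last (u ∷ vs) ≡ just v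
  walk⇒SimplePath here = [] , simplePath ([] ∷ []) [-] , refl
  walk⇒SimplePath (step {u} {w} uw walk) with walk⇒SimplePath walk
  ... | vs , simplePath distinct linked , ends with u ∈? w ∷ vs
  ...   | yes u∈ = suffixFrom u∈ , simplePath (suffixFrom-Unique distinct u∈) (suffixFrom-Linked linked u∈) ,
                   ≡.trans (last-suffixFrom u∈) ends
  ...   | no u∉  = w ∷ vs , simplePath (¬Any⇒All¬ _ u∉ ∷ distinct) (uw ∷ linked) , ends

  chord⇒Cycle : ∀ {G : Graph n} {x w y ys} → SimplePath G (x ∷ w ∷ ys) → y ∈ ys → Adj G y x → Cycle G
  chord⇒Cycle {x = x} {w} {y} {ys} (simplePath distinct linked) y∈ys yx = record
    { verts    = prefixTo y∈xs
    ; long     = s≤s (s≤s (length-prefixTo y∈ys))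
    ; distinct = prefixTo-Unique distinct y∈xs
    ; path     = prefixTo-Linked linked y∈xs
    ; first    = x
    ; lst      = y
    ; isFirst  = refl
    ; isLast   = last-prefixTo y∈xs
    ; closing  = yx
    }
    where
    y∈xs : y ∈ x ∷ w ∷ ys
    y∈xs = there (there y∈ys)

  twoNeighboursOnPath⇒Cycle : ∀ {G : Graph n} {z x y vs} → SimplePath G vs → z ∉ vs →
                              x ∈ vs → y ∈ vs → x ≢ y → Adj G z x → Adj G z y → Cycle G
  twoNeighboursOnPath⇒Cycle _ _ (here refl) (here refl) x≢y _ _ = ⊥-elim (x≢y refl)
  twoNeighboursOnPath⇒Cycle {G} (simplePath distinct linked) z∉vs (here refl) (there y∈vs) _ zx zy =
    chord⇒Cycle (simplePath (¬Any⇒All¬ _ z∉vs ∷ distinct) (zx ∷ linked)) y∈vs (Adj-sym G zy)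
  twoNeighboursOnPath⇒Cycle {G} (simplePath distinct linked) z∉vs (there x∈vs) (here refl) _ zx zy =
    chord⇒Cycle (simplePath (¬Any⇒All¬ _ z∉vs ∷ distinct) (zy ∷ linked)) x∈vs (Adj-sym G zx)
  twoNeighboursOnPath⇒Cycle path z∉vs (there x∈vs) (there y∈vs) x≢y zx zy =
    twoNeighboursOnPath⇒Cycle (SimplePath-tail path) (z∉vs ∘ there) x∈vs y∈vs x≢y zx zy

  IsEdge : Graph n → Fin n × Fin n → Bool
  IsEdge G (i , j) = (toℕ i <ᵇ toℕ j) ∧ adj G i j

  IsEdge⁻ : ∀ (G : Graph n) i j → T (IsEdge G (i , j)) → toℕ i < toℕ j × Adj G i j
  IsEdge⁻ G i j e with i<j , ij ← Equivalence.to T-∧ e = <ᵇ⇒< (toℕ i) (toℕ j) i<j , Equivalence.to T-≡ ij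

  edgeOutside : ∀ {H G : Graph n} → numEdges H < numEdges G → ∃₂ λ u v → Adj G u v × ¬ Adj H u v
  edgeOutside {H} {G} H<G
    with (u , v) , ¬Huv , Guv ← countᵇ-<⇒∃ {p = IsEdge H} {q = IsEdge G} (pairs n) H<G =
    u , v , proj₂ (IsEdge⁻ G u v Guv) ,
    λ Huv → ¬Huv (Equivalence.from T-∧ (proj₁ (Equivalence.to T-∧ Guv) , Equivalence.from T-≡ Huv))

  ∣_∣ : (Fin n → Bool) → ℕ
  ∣ A ∣ = countᵇ A (allFin n)

  _∖_ : (Fin n → Bool) → Fin n → Fin n → Bool
  (A ∖ x) t = A t ∧ not (does (t ≟ x))

  ∈-∖⁺ : ∀ {A x t} → T (A t) → t ≢ x → T ((A ∖ x) t)
  ∈-∖⁺ {x = x} {t} At t≢x = Equivalence.from T-∧ (At , T-not-does⁺ (t ≟ x) t≢x)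

  ∣∖∣ : ∀ {A x} → T (A x) → ∣ A ∣ ≡ suc ∣ A ∖ x ∣
  ∣∖∣ {A} {x} Ax = countᵇ-remove (allFin n) (allFin⁺ n) (∈-allFin x) Ax
    (λ Ax∖x → T-not-does⁻ (x ≟ x) (proj₂ (Equivalence.to T-∧ Ax∖x)) refl)
    (λ {t} t≢x → ≡.trans (≡.cong (λ b → A t ∧ not b) (dec-false (t ≟ x) t≢x)) (∧-identityʳ (A t)))

  IsEdgeIn : Graph n → (Fin n → Bool) → Fin n × Fin n → Bool
  IsEdgeIn G A (i , j) = A i ∧ A j ∧ IsEdge G (i , j)

  edgesIn : Graph n → (Fin n → Bool) → ℕ
  edgesIn G A = countᵇ (IsEdgeIn G A) (pairs n)

  edgesAt : Graph n → (Fin n → Bool) → Fin n → ℕ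
  edgesAt G A x = countᵇ (λ e → IsEdgeIn G A e ∧ not (IsEdgeIn G (A ∖ x) e)) (pairs n)

  edgeAt⁻ : ∀ {G : Graph n} {A x i j} → T (IsEdgeIn G A (i , j) ∧ not (IsEdgeIn G (A ∖ x) (i , j))) →
            T (A i) × T (A j) × toℕ i < toℕ j × Adj G i j × (i ≡ x ⊎ j ≡ x)
  edgeAt⁻ {G} {A} {x} {i} {j} e =
    let Ai , Aj , ij , i≡x⊎j≡x = cut (A i) (A j) (IsEdge G (i , j)) (does (i ≟ x)) (does (j ≟ x)) e
    in  Ai , Aj , proj₁ (IsEdge⁻ G i j ij) , proj₂ (IsEdge⁻ G i j ij) ,
        Sum.map (T-does⁻ (i ≟ x)) (T-does⁻ (j ≟ x)) i≡x⊎j≡x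
    where
    cut : ∀ a b c d e → T ((a ∧ b ∧ c) ∧ not ((a ∧ not d) ∧ (b ∧ not e) ∧ c)) →
          T a × T b × T c × (T d ⊎ T e)
    cut true  true  true  true  _     _ = _ , _ , _ , inj₁ _
    cut true  true  true  false true  _ = _ , _ , _ , inj₂ _
    cut true  true  true  false false ()
    cut true  true  false _     _     ()
    cut true  false _     _     _     ()
    cut false _     _     _     _     ()

  AtMostOneNeighbourIn : Graph n → (Fin n → Bool) → Fin n → Set
  AtMostOneNeighbourIn G A x = ∀ {y z} → T (A y) → T (A z) → Adj G x y → Adj G x z → y ≡ z

  edgesAt-unique : ∀ {G : Graph n} {A x} → AtMostOneNeighbourIn G A x → ∀ {e f} →
                   T (IsEdgeIn G A e ∧ not (IsEdgeIn G (A ∖ x) e)) →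
                   T (IsEdgeIn G A f ∧ not (IsEdgeIn G (A ∖ x) f)) → e ≡ f
  edgesAt-unique {G} {A} {x} leaf {i , j} {k , l} e f
    with edgeAt⁻ {G} {A} {x} {i} {j} e | edgeAt⁻ {G} {A} {x} {k} {l} f
  ... | _ , Aj , _ , ij , inj₁ refl | _ , Al , _ , kl , inj₁ refl = ≡.cong (i ,_) (leaf Aj Al ij kl)
  ... | _ , Aj , i<j , ij , inj₁ refl | Ak , _ , k<l , kl , inj₂ refl with refl ← leaf Aj Ak ij (Adj-sym G kl) =
    ⊥-elim (<-asym i<j k<l)
  ... | Ai , _ , i<j , ij , inj₂ refl | _ , Al , k<l , kl , inj₁ refl with refl ← leaf Ai Al (Adj-sym G ij) kl =
    ⊥-elim (<-asym i<j k<l)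
  ... | Ai , _ , _ , ij , inj₂ refl | Ak , _ , _ , kl , inj₂ refl =
    ≡.cong (_, j) (leaf Ai Ak (Adj-sym G ij) (Adj-sym G kl))

  edgesAt≤1 : ∀ {G : Graph n} {A x} → AtMostOneNeighbourIn G A x → edgesAt G A x ≤ 1
  edgesAt≤1 {G} {A} {x} leaf = countᵇ-≤1 (pairs n) Unique-pairs (edgesAt-unique {G} {A} {x} leaf)

  edgesAt>0⇒∣∖∣>0 : ∀ {G : Graph n} {A x} → 0 < edgesAt G A x → 0 < ∣ A ∖ x ∣
  edgesAt>0⇒∣∖∣>0 {G} {A} {x} pos
    with (i , j) , _ , e ← countᵇ>0⇒∃ (pairs n) pos
    with edgeAt⁻ {G} {A} {x} {i} {j} e
  ... | _  , Aj , _ , ij , inj₁ refl =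
    ∈⇒countᵇ>0 (allFin n) (∈-allFin j) (∈-∖⁺ {A} Aj (Adj-irrefl G ij ∘ ≡.sym))
  ... | Ai , _  , _ , ij , inj₂ refl =
    ∈⇒countᵇ>0 (allFin n) (∈-allFin i) (∈-∖⁺ {A} Ai (Adj-irrefl G ij))

  module _ {G : Graph n} (acyclic : Acyclic G) (A : Fin n → Bool) where

    neighboursOnPath⇒AtMostOneNeighbourIn : ∀ {h rest} → SimplePath G (h ∷ rest) →
      (∀ {a} → T (A a) → Adj G h a → a ∈ h ∷ rest) → AtMostOneNeighbourIn G A h
    neighboursOnPath⇒AtMostOneNeighbourIn {h} {[]} _ onPath Ay _ hy _ with onPath Ay hy
    ... | here y≡h = ⊥-elim (Adj-irrefl G hy (≡.sym y≡h))
    neighboursOnPath⇒AtMostOneNeighbourIn {h} {q ∷ rest} path onPath Ay Az hy hz =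
      ≡.trans (neighbour≡q Ay hy) (≡.sym (neighbour≡q Az hz))
      where
      neighbour≡q : ∀ {a} → T (A a) → Adj G h a → a ≡ q
      neighbour≡q Aa ha with onPath Aa ha
      ... | here a≡h             = ⊥-elim (Adj-irrefl G ha (≡.sym a≡h))
      ... | there (here a≡q)     = a≡q
      ... | there (there a∈rest) = ⊥-elim (acyclic (chord⇒Cycle path a∈rest (Adj-sym G ha)))

    -- The fuel suffices: each step adds a vertex to the path, and a simple path has at most n vertices.
    leafFrom : ∀ fuel {h rest} → SimplePath G (h ∷ rest) → All (T ∘ A) (h ∷ rest) →
               n < fuel + length (h ∷ rest) → ∃ λ x → T (A x) × AtMostOneNeighbourIn G A x
    leafFrom zero (simplePath distinct _) _ bound = ⊥-elim (<⇒≱ bound (Unique⇒length≤ distinct))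
    leafFrom (suc fuel) {h} {rest} path@(simplePath distinct linked) inA@(Ah ∷ _) bound
      with any? (λ a → T? (A a) ×-dec (adj G h a ≟ᵇ true) ×-dec ¬? (a ∈? h ∷ rest))
    ... | yes (a , Aa , ha , a∉path) =
          leafFrom fuel (simplePath (¬Any⇒All¬ _ a∉path ∷ distinct) (Adj-sym G ha ∷ linked)) (Aa ∷ inA)
                   (≡.subst (n <_) (≡.sym (+-suc fuel _)) bound)
    ... | no noExit = h , Ah , neighboursOnPath⇒AtMostOneNeighbourIn path λ Aa ha →
          decidable-stable (_ ∈? _) λ a∉path → noExit (_ , Aa , ha , a∉path)

    leafIn : ∀ {x₀} → T (A x₀) → ∃ λ x → T (A x) × AtMostOneNeighbourIn G A x
    leafIn Ax₀ = leafFrom n (simplePath ([] ∷ []) [-]) (Ax₀ ∷ []) (m<m+n n z<s)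

  edgesIn-acyclic : ∀ {G : Graph n} → Acyclic G → ∀ m A → ∣ A ∣ ≡ m → edgesIn G A ≤ pred m
  edgesIn-acyclic _ zero A ∣A∣≡0 = ≮⇒≥ λ pos →
    let (i , _) , _ , e = countᵇ>0⇒∃ (pairs n) pos
    in  n≮0 (≡.subst (0 <_) ∣A∣≡0 (∈⇒countᵇ>0 (allFin n) (∈-allFin i) (proj₁ (Equivalence.to T-∧ e))))
  edgesIn-acyclic {G} acyclic (suc m) A ∣A∣≡1+m
    with _ , _ , Ax₀ ← countᵇ>0⇒∃ (allFin n) (≡.subst (0 <_) (≡.sym ∣A∣≡1+m) z<s)
    with x , Ax , leaf ← leafIn acyclic A Ax₀ =
    begin
      edgesIn G A
        ≤⟨ countᵇ-≤-+ (IsEdgeIn G A) (IsEdgeIn G (A ∖ x)) (pairs n) ⟩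
      edgesIn G (A ∖ x) + edgesAt G A x
        ≤⟨ +-monoˡ-≤ (edgesAt G A x) (edgesIn-acyclic acyclic m (A ∖ x) ∣A∖x∣≡m) ⟩
      pred m + edgesAt G A x
        ≤⟨ pred-+-≤ (edgesAt≤1 {G} leaf) (≡.subst (0 <_) ∣A∖x∣≡m ∘ edgesAt>0⇒∣∖∣>0 {G}) ⟩
      m ∎
    where
    open ≤-Reasoning
    ∣A∖x∣≡m : ∣ A ∖ x ∣ ≡ m
    ∣A∖x∣≡m = suc-injective (≡.trans (≡.sym (∣∖∣ {A} Ax)) ∣A∣≡1+m)

  numEdges-acyclic : ∀ {G : Graph n} → Acyclic G → numEdges G ≤ pred n
  numEdges-acyclic acyclic =
    edgesIn-acyclic acyclic n (λ _ → true) (≡.trans (countᵇ-true (allFin n)) (length-tabulate _))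

  vertexSet : List (Fin n) → Vec Bool n
  vertexSet vs = tabulate (λ i → ⌊ i ∈? vs ⌋)

  ∈-vertexSet⁺ : ∀ {i vs} → i ∈ vs → T (vlookup (vertexSet vs) i)
  ∈-vertexSet⁺ {i} i∈vs = ≡.subst T (≡.sym (lookup∘tabulate _ i)) (fromWitness i∈vs)

  ∈-vertexSet⁻ : ∀ {i vs} → T (vlookup (vertexSet vs) i) → i ∈ vs
  ∈-vertexSet⁻ {i} i∈S = toWitness (≡.subst T (lookup∘tabulate _ i) i∈S)

  P3Convex : Graph n → Vec Bool n → Set
  P3Convex G S = ∀ {x z y} → x ≢ z → z ≢ y → x ≢ y → Adj G x z → Adj G z y →
                 T (vlookup S x) → T (vlookup S y) → T (vlookup S z)

  isP3Convex⇒P3Convex : ∀ {G : Graph n} {S} → T (isP3Convex G S) → P3Convex G S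
  isP3Convex⇒P3Convex convex {x} {z} {y} x≢z z≢y x≢y xz zy x∈S y∈S =
    $ᵇ-last (All.lookup (all⁺ _ (triples n) convex) (∈-triples x z y)
               $ᵇ T-not-does⁺ (x ≟ z) x≢z $ᵇ T-not-does⁺ (z ≟ y) z≢y $ᵇ T-not-does⁺ (x ≟ y) x≢y
               $ᵇ Equivalence.from T-≡ xz $ᵇ Equivalence.from T-≡ zy $ᵇ x∈S)
            y∈S

  P3Convex⇒isP3Convex : ∀ {G : Graph n} {S} → P3Convex G S → T (isP3Convex G S)
  P3Convex⇒isP3Convex convex = all⁻ _ {triples n} (All.tabulate λ { {x , z , y} _ →
    λᵇ _ λ x≢z → λᵇ _ λ z≢y → λᵇ _ λ x≢y → λᵇ _ λ xz → λᵇ _ λ zy → λᵇ _ λ x∈S →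
    λᵇ-last _ λ y∈S →
    convex (T-not-does⁻ (x ≟ z) x≢z) (T-not-does⁻ (z ≟ y) z≢y) (T-not-does⁻ (x ≟ y) x≢y)
           (Equivalence.to T-≡ xz) (Equivalence.to T-≡ zy) x∈S y∈S })

  P3Convex-subgraph : ∀ {H G : Graph n} {S} → SubgraphOf H G → P3Convex G S → P3Convex H S
  P3Convex-subgraph H⊆G convex x≢z z≢y x≢y xz zy = convex x≢z z≢y x≢y (H⊆G _ _ xz) (H⊆G _ _ zy)

  noc-< : ∀ {H G : Graph n} S → SubgraphOf H G → P3Convex H S → ¬ P3Convex G S → noc G < noc H
  noc-< {H} {G} S H⊆G convexH ¬convexG =
    countᵇ-mono-< (subsets n)
      (λ {s} → P3Convex⇒isP3Convex {H} {s} ∘ P3Convex-subgraph {H} {G} {s} H⊆G ∘ isP3Convex⇒P3Convex {G} {s})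
      (∈-subsets S) (¬convexG ∘ isP3Convex⇒P3Convex {G} {S}) (P3Convex⇒isP3Convex {H} {S} convexH)

  SimplePath⇒P3Convex : ∀ {G : Graph n} {vs} → Acyclic G → SimplePath G vs → P3Convex G (vertexSet vs)
  SimplePath⇒P3Convex {G} {vs} acyclic path {z = z} _ _ x≢y xz zy x∈S y∈S with z ∈? vs
  ... | yes z∈vs = ∈-vertexSet⁺ z∈vs
  ... | no  z∉vs = ⊥-elim (acyclic (twoNeighboursOnPath⇒Cycle path z∉vs
                     (∈-vertexSet⁻ x∈S) (∈-vertexSet⁻ y∈S) x≢y (Adj-sym G xz) zy))

  pathTail-¬P3Convex : ∀ {H G : Graph n} {u v w vs} → SubgraphOf H G → SimplePath H (u ∷ w ∷ vs) →
                       last (w ∷ vs) ≡ just v → Adj G u v → ¬ Adj H u v → ¬ P3Convex G (vertexSet (w ∷ vs))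
  pathTail-¬P3Convex {H} {G} {u} {w = w} {vs} H⊆G (simplePath (u∉ ∷ _) (uw ∷ _)) ends uv ¬Huv convex =
    All.lookup u∉ (∈-vertexSet⁻ u∈S) refl
    where
    u∈S : T (vlookup (vertexSet (w ∷ vs)) u)
    u∈S = convex (Adj-irrefl G (Adj-sym G uv)) (Adj-irrefl H uw) (λ { refl → ¬Huv uw })
                 (Adj-sym G uv) (H⊆G _ _ uw) (∈-vertexSet⁺ (last⇒∈ _ ends)) (∈-vertexSet⁺ (here refl))

lemma2p7 : (n : ℕ) → 3 ≤ n → (G : Graph n) → Connected G → numEdges G ≡ n →
    (T : Graph n) → IsSpanningTree T G → noc G < noc T
lemma2p7 (suc k) (s≤s _) G _ |E|≡n T (T⊆G , T-connected , T-acyclic)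
  with u , v , Guv , ¬Tuv ← edgeOutside {H = T} {G = G}
                               (≡.subst (numEdges T <_) (≡.sym |E|≡n) (s≤s (numEdges-acyclic T-acyclic)))
  with walk⇒SimplePath (T-connected u v)
... | []     , _    , refl = ⊥-elim (Adj-irrefl G Guv refl)
... | w ∷ vs , path , ends =
  noc-< {H = T} {G = G} (vertexSet (w ∷ vs)) T⊆G (SimplePath⇒P3Convex T-acyclic (SimplePath-tail path))
    (pathTail-¬P3Convex {H = T} {G = G} T⊆G path ends Guv ¬Tuv)
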